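{- Let $k \ge 2$ and $N \ge 1$ be integers with $N \ge k$ and $k \nmid N$. If there exist positive integers $A, B$ such that $(A)_k$ and $(B)_k$ are palindromes and $A/B = N$, then, for such a pair with $A$ smallest, the length of $(A)_k$ satisfies $$|(A)_k| \le 2\left(\lceil \log_k N\rceil + k^{\lceil \log_k N\rceil} N^2 + \left\lceil \frac{\log_k N}{2}\right\rceil\right) + 1.$$
   Context: For a positive integer $n$, $(n)_k$ denotes the base-$k$ representation of $n$ as a string of digits in $\{0,\dots,k-1\}$ starting with a nonzero most significant digit; $|w|$ denotes the length of a string $w$. A string is a palindrome if it reads the same forwards and backwards. -}

module Defs where

open import Data.Nat using (ℕ; zero; suc; _+_; _*_; _^_; _≤_; _≤?_; _/_; _%_)
open import Data.List using (List; []; _∷_; reverse; length)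
open import Relation.Nullary using (yes; no)
open import Relation.Binary.PropositionalEquality using (_≡_)
open import Data.Product using (_×_)

-- Base-k digits of n, least significant digit first, with no leading
-- (most significant) zeros; digits of 0 is [].  The fuel argument is n
-- itself, which suffices for k ≥ 2 (each step at least halves n).
digitsFuel : ℕ → ℕ → ℕ → List ℕ
digitsFuel zero    k n       = []
digitsFuel (suc f) k zero    = []
digitsFuel (suc f) zero    (suc n) = []
digitsFuel (suc f) (suc k) (suc n) =
  (suc n % suc k) ∷ digitsFuel f (suc k) (suc n / suc k)

digits : ℕ → ℕ → List ℕ
digits k n = digitsFuel n k n

Palindrome : List ℕ → Set
Palindrome w = reverse w ≡ w

leastExpFrom : ℕ → ℕ → ℕ → ℕ → ℕ → ℕ
leastExpFrom zero    k m N e = e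
leastExpFrom (suc f) k m N e with N ≤? k ^ (m * e)
... | yes _ = e
... | no  _ = leastExpFrom f k m N (suc e)

-- ⌈log_k N⌉ = least e with N ≤ k^e   (for k ≥ 2, N ≥ 1; fuel N suffices)
ceilLog : ℕ → ℕ → ℕ
ceilLog k N = leastExpFrom N k 1 N 0

-- ⌈(log_k N)/2⌉ = least f with N ≤ k^(2f)  (for k ≥ 2, N ≥ 1)
ceilHalfLog : ℕ → ℕ → ℕ
ceilHalfLog k N = leastExpFrom N k 2 N 0

GoodPair : ℕ → ℕ → ℕ → ℕ → Set
GoodPair k N A B =
  (1 ≤ A) × (1 ≤ B) × Palindrome (digits k A) × Palindrome (digits k B) × (A ≡ N * B)

-- Write α and β for the base-k digit strings of A and B (least significant digit
-- first), of lengths L ≥ M, and let d = L − M ≤ ⌈log_k N⌉.  Multiplying by N digit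
-- by digit, with carries in [0, N), turns β followed by d zeros into α.  For each
-- position m ≥ 1 with 2m + d ≤ M record the carry after the first m + d digits of β,
-- the carry before its last m digits, and the d digits following position m: at
-- most K = N²·k^d values.  If two positions m₁ < m₂ record the same value, deleting
-- the digits in [m₁, m₂) and their mirror image from β gives a palindrome B′ whose
-- product A′ = N·B′ is again a palindrome, shorter than α.  So for minimal A all
-- these positions are distinct, whence M ≤ 2K + d + 1 and L ≤ 2(d + K) + 1.
module Submission where

open import Defs
open import Data.Nat using (ℕ; zero; suc; s≤s⁻¹; NonZero; >-nonZero⁻¹; _⊓_; _+_; _*_; _∸_; _^_; _≤_; _<_; z≤n; s≤s; _/_; _%_; _≤?_)
open import Data.Nat.Properties
open import Data.Nat.Divisibility using (_∣_)
open import Data.List using (List; []; _∷_; _++_; _∷ʳ_; [_]; length; reverse; take; drop; replicate; foldl)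
open import Data.List.Properties using (length-drop; ++-cancelˡ; ++-cancelʳ; length-replicate; ++-assoc; ++-identityʳ; length-++; length-reverse; reverse-++; reverse-involutive; unfold-reverse; take++drop≡id; take-take; length-take; foldl-++; ∷-injective)
open import Data.List.Relation.Unary.All using (All; []; _∷_)
open import Data.List.Relation.Unary.All.Properties using (++⁺; ++⁻ˡ; ++⁻ʳ; take⁺; drop⁺)
open import Data.Nat.DivMod using (m<n*o⇒m/o<n; m≡m%n+[m/n]*n; [m+kn]%n≡m%n; m<n⇒m%n≡m; m<n⇒m/n≡0; +-distrib-/-∣ʳ; m*n/n≡m; m/n<m; m%n<n)
open import Data.Nat.Divisibility using (n∣m*n)
open import Data.Nat.Tactic.RingSolver using (solve-∀)
open import Data.Fin using (Fin; toℕ; fromℕ<; combine)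
open import Data.Fin.Properties using (toℕ<n; fromℕ<-injective; combine-injectiveˡ; combine-injectiveʳ; pigeonhole)
open import Data.Product using (_×_; _,_; proj₁; proj₂; ∃₂)
open import Relation.Nullary using (¬_; yes; no; contradiction)
open import Relation.Binary.PropositionalEquality hiding ([_])

module _ {a} {A : Set a} where

  ++-injective-length : ∀ (xs xs′ : List A) {ys ys′} → length xs ≡ length xs′ →
    xs ++ ys ≡ xs′ ++ ys′ → xs ≡ xs′ × ys ≡ ys′
  ++-injective-length []       []         _   eq = refl , eq
  ++-injective-length (x ∷ xs) (x′ ∷ xs′) len eq with ∷-injective eq
  ... | refl , eq′ with ++-injective-length xs xs′ (suc-injective len) eq′
  ...   | refl , eq″ = refl , eq″

  take-++ˡ : ∀ n (xs ys : List A) → n ≤ length xs → take n (xs ++ ys) ≡ take n xs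
  take-++ˡ zero    xs       ys _         = refl
  take-++ˡ (suc n) (x ∷ xs) ys (s≤s n≤) = cong (x ∷_) (take-++ˡ n xs ys n≤)

  take-length-++ : ∀ (xs ys : List A) → take (length xs) (xs ++ ys) ≡ xs
  take-length-++ []       ys = refl
  take-length-++ (x ∷ xs) ys = cong (x ∷_) (take-length-++ xs ys)

  take-prefix : ∀ {m n} (xs : List A) → m ≤ n → take n xs ≡ take m xs ++ drop m (take n xs)
  take-prefix {m} {n} xs m≤n = begin
    take n xs                                   ≡⟨ take++drop≡id m (take n xs) ⟨
    take m (take n xs) ++ drop m (take n xs)    ≡⟨ cong (_++ drop m (take n xs)) (take-take m n xs) ⟩
    take (m ⊓ n) xs ++ drop m (take n xs)       ≡⟨ cong (λ i → take i xs ++ drop m (take n xs)) (m≤n⇒m⊓n≡m m≤n) ⟩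
    take m xs ++ drop m (take n xs) ∎
    where open ≡-Reasoning

  take-shift : ∀ n (xs ys zs : List A) → n ≤ length ys → take n (xs ++ ys ++ zs) ≡ take n ys →
    xs ++ take n ys ≡ take n ys ++ drop n (xs ++ take n ys)
  take-shift n xs ys zs n≤|ys| same = begin
    xs ++ w                                ≡⟨ take++drop≡id n (xs ++ w) ⟨
    take n (xs ++ w) ++ drop n (xs ++ w)   ≡⟨ cong (_++ drop n (xs ++ w)) take-n≡w ⟩
    w ++ drop n (xs ++ w) ∎
    where
    open ≡-Reasoning
    w : List A
    w = take n ys
    n≤|xs++w| : n ≤ length (xs ++ w)
    n≤|xs++w| = subst (n ≤_) (sym (trans (length-++ xs) (cong (length xs +_)
      (trans (length-take n ys) (m≤n⇒m⊓n≡m n≤|ys|))))) (m≤n+m n (length xs))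
    take-n≡w : take n (xs ++ w) ≡ w
    take-n≡w = begin
      take n (xs ++ w)                        ≡⟨ take-++ˡ n (xs ++ w) _ n≤|xs++w| ⟨
      take n ((xs ++ w) ++ drop n ys ++ zs)   ≡⟨ cong (take n) (++-assoc xs w _) ⟩
      take n (xs ++ w ++ drop n ys ++ zs)     ≡⟨ cong (λ U → take n (xs ++ U)) (++-assoc w (drop n ys) zs) ⟨
      take n (xs ++ (w ++ drop n ys) ++ zs)   ≡⟨ cong (λ U → take n (xs ++ U ++ zs)) (take++drop≡id n ys) ⟩
      take n (xs ++ ys ++ zs)                 ≡⟨ same ⟩
      w ∎

  trim : ℕ → List A → List A
  trim m xs = drop m (take (length xs ∸ m) xs)

  palindrome-split : ∀ m (xs : List A) → reverse xs ≡ xs → m + m ≤ length xs →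
    xs ≡ take m xs ++ trim m xs ++ reverse (take m xs)
  palindrome-split m xs pal 2m≤ = begin
    xs                                          ≡⟨ take++drop≡id (n ∸ m) xs ⟨
    front ++ back                               ≡⟨ cong (_++ back) (take-prefix xs m≤n∸m) ⟩
    (take m xs ++ trim m xs) ++ back            ≡⟨ cong ((take m xs ++ trim m xs) ++_) back≡ ⟩
    (take m xs ++ trim m xs) ++ reverse (take m xs) ≡⟨ ++-assoc (take m xs) _ _ ⟩
    take m xs ++ trim m xs ++ reverse (take m xs) ∎
    where
    open ≡-Reasoning
    n : ℕ
    n = length xs
    front back : List A
    front = take (n ∸ m) xs
    back = drop (n ∸ m) xs
    m≤n∸m : m ≤ n ∸ m
    m≤n∸m = subst (_≤ n ∸ m) (m+n∸n≡m m m) (∸-monoˡ-≤ m 2m≤)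
    length-back : length (reverse back) ≡ m
    length-back = trans (length-reverse back)
      (trans (length-drop (n ∸ m) xs) (m∸[m∸n]≡n (≤-trans (m≤n+m m m) 2m≤)))
    take-m≡reverse-back : take m xs ≡ reverse back
    take-m≡reverse-back = begin
      take m xs                                  ≡⟨ cong (take m) (trans (sym pal) (cong reverse (sym (take++drop≡id (n ∸ m) xs)))) ⟩
      take m (reverse (front ++ back))           ≡⟨ cong (take m) (reverse-++ front back) ⟩
      take m (reverse back ++ reverse front)     ≡⟨ cong (λ i → take i (reverse back ++ reverse front)) length-back ⟨
      take (length (reverse back)) (reverse back ++ reverse front) ≡⟨ take-length-++ (reverse back) _ ⟩
      reverse back ∎
    back≡ : back ≡ reverse (take m xs)
    back≡ = trans (sym (reverse-involutive back)) (cong reverse (sym take-m≡reverse-back))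

  palindrome-layers : ∀ m₁ m₂ (xs : List A) → reverse xs ≡ xs → m₁ ≤ m₂ → m₂ + m₂ ≤ length xs →
    let P = take m₁ xs
        Q = drop m₁ (take m₂ xs)
    in xs ≡ P ++ Q ++ trim m₂ xs ++ reverse Q ++ reverse P × trim m₁ xs ≡ Q ++ trim m₂ xs ++ reverse Q
  palindrome-layers m₁ m₂ xs pal m₁≤m₂ 2m₂≤ = xs≡ , trim₁≡
    where
    open ≡-Reasoning
    P Q R : List A
    P = take m₁ xs
    Q = drop m₁ (take m₂ xs)
    R = trim m₂ xs
    xs≡ : xs ≡ P ++ Q ++ R ++ reverse Q ++ reverse P
    xs≡ = begin
      xs                                       ≡⟨ palindrome-split m₂ xs pal 2m₂≤ ⟩
      take m₂ xs ++ R ++ reverse (take m₂ xs)  ≡⟨ cong (λ U → U ++ R ++ reverse U) (take-prefix xs m₁≤m₂) ⟩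
      (P ++ Q) ++ R ++ reverse (P ++ Q)        ≡⟨ cong (λ U → (P ++ Q) ++ R ++ U) (reverse-++ P Q) ⟩
      (P ++ Q) ++ R ++ reverse Q ++ reverse P  ≡⟨ ++-assoc P Q _ ⟩
      P ++ Q ++ R ++ reverse Q ++ reverse P ∎
    trim₁≡ : trim m₁ xs ≡ Q ++ R ++ reverse Q
    trim₁≡ = ++-cancelʳ (reverse P) (trim m₁ xs) _ (++-cancelˡ P _ _ (begin
      P ++ trim m₁ xs ++ reverse P             ≡⟨ palindrome-split m₁ xs pal (≤-trans (+-mono-≤ m₁≤m₂ m₁≤m₂) 2m₂≤) ⟨
      xs                                       ≡⟨ xs≡ ⟩
      P ++ Q ++ R ++ reverse Q ++ reverse P    ≡⟨ cong (λ U → P ++ Q ++ U) (++-assoc R (reverse Q) (reverse P)) ⟨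
      P ++ Q ++ (R ++ reverse Q) ++ reverse P  ≡⟨ cong (P ++_) (++-assoc Q (R ++ reverse Q) (reverse P)) ⟨
      P ++ (Q ++ R ++ reverse Q) ++ reverse P ∎))

  ++-assoc₅ : ∀ (a b c d e f : List A) → (a ++ b ++ c ++ d ++ e) ++ f ≡ a ++ b ++ c ++ d ++ e ++ f
  ++-assoc₅ a b c d e f =
    trans (++-assoc a _ f) (cong (a ++_)
    (trans (++-assoc b _ f) (cong (b ++_)
    (trans (++-assoc c _ f) (cong (c ++_) (++-assoc d e f))))))

  reverse-++₅ : ∀ (a b c d e : List A) →
    reverse (a ++ b ++ c ++ d ++ e) ≡ reverse e ++ reverse d ++ reverse c ++ reverse b ++ reverse a
  reverse-++₅ a b c d e = begin
    reverse (a ++ b ++ c ++ d ++ e)                             ≡⟨ reverse-++ a _ ⟩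
    reverse (b ++ c ++ d ++ e) ++ reverse a                     ≡⟨ cong (_++ reverse a) (reverse-++ b _) ⟩
    (reverse (c ++ d ++ e) ++ reverse b) ++ reverse a           ≡⟨ ++-assoc (reverse (c ++ d ++ e)) (reverse b) _ ⟩
    reverse (c ++ d ++ e) ++ reverse b ++ reverse a             ≡⟨ cong (_++ _) (reverse-++ c _) ⟩
    (reverse (d ++ e) ++ reverse c) ++ reverse b ++ reverse a   ≡⟨ ++-assoc (reverse (d ++ e)) (reverse c) _ ⟩
    reverse (d ++ e) ++ reverse c ++ reverse b ++ reverse a     ≡⟨ cong (_++ _) (reverse-++ d e) ⟩
    (reverse e ++ reverse d) ++ reverse c ++ reverse b ++ reverse a ≡⟨ ++-assoc (reverse e) _ _ ⟩
    reverse e ++ reverse d ++ reverse c ++ reverse b ++ reverse a ∎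
    where open ≡-Reasoning

  length-delete : ∀ (a b c b′ a′ : List A) →
    length (a ++ b ++ c ++ b′ ++ a′) ≡ length (a ++ c ++ a′) + (length b + length b′)
  length-delete a b c b′ a′
    rewrite length-++ a {b ++ c ++ b′ ++ a′} | length-++ b {c ++ b′ ++ a′} | length-++ c {b′ ++ a′}
          | length-++ b′ {a′} | length-++ a {c ++ a′} | length-++ c {a′}
          = solve-∀′ (length a) (length b) (length c) (length b′) (length a′)
    where
    solve-∀′ : ∀ a b c b′ a′ → a + (b + (c + (b′ + a′))) ≡ a + (c + a′) + (b + b′)
    solve-∀′ = solve-∀

  palindrome-delete : ∀ (a b c b′ a′ : List A) → length a ≡ length a′ → length b ≡ length b′ →
    reverse (a ++ b ++ c ++ b′ ++ a′) ≡ a ++ b ++ c ++ b′ ++ a′ →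
    reverse (a ++ c ++ a′) ≡ a ++ c ++ a′
  palindrome-delete a b c b′ a′ |a|≡|a′| |b|≡|b′| pal
    with ++-injective-length (reverse a′) a (trans (length-reverse a′) (sym |a|≡|a′|))
           (trans (sym (reverse-++₅ a b c b′ a′)) pal)
  ... | refl , pal₁ with ++-injective-length (reverse b′) b (trans (length-reverse b′) (sym |b|≡|b′|)) pal₁
  ...   | _ , pal₂ with ++-injective-length (reverse c) c (length-reverse c) pal₂
  ...     | rev-c , _ = begin
    reverse (reverse a′ ++ c ++ a′)              ≡⟨ reverse-++ (reverse a′) _ ⟩
    reverse (c ++ a′) ++ reverse (reverse a′)    ≡⟨ cong₂ _++_ (reverse-++ c a′) (reverse-involutive a′) ⟩
    (reverse a′ ++ reverse c) ++ a′              ≡⟨ ++-assoc (reverse a′) _ _ ⟩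
    reverse a′ ++ reverse c ++ a′                ≡⟨ cong (λ u → reverse a′ ++ u ++ a′) rev-c ⟩
    reverse a′ ++ c ++ a′ ∎
    where open ≡-Reasoning

module Transducer {a b s} {A : Set a} {B : Set b} {S : Set s}
                  (next : S → A → S) (emit : S → A → B) where

  run : S → List A → List B
  run s []       = []
  run s (x ∷ xs) = emit s x ∷ run (next s x) xs

  final : S → List A → S
  final = foldl next

  length-run : ∀ s xs → length (run s xs) ≡ length xs
  length-run s []       = refl
  length-run s (x ∷ xs) = cong suc (length-run (next s x) xs)

  run-++ : ∀ s xs ys → run s (xs ++ ys) ≡ run s xs ++ run (final s xs) ys
  run-++ s []       ys = refl
  run-++ s (x ∷ xs) ys = cong (emit s x ∷_) (run-++ (next s x) xs ys)

  final-++ : ∀ s xs ys → final s (xs ++ ys) ≡ final (final s xs) ys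
  final-++ = foldl-++ next

  module _ (s : S) (x₁ x₂ z y₂ y₁ : List A)
           (loop₁ : final s (x₁ ++ x₂) ≡ final s x₁)
           (loop₂ : final s (x₁ ++ x₂ ++ z ++ y₂) ≡ final s (x₁ ++ x₂ ++ z)) where

    private
      s₁ s₂ : S
      s₁ = final s x₁
      s₂ = final s₁ z

      loop₁′ : final s₁ x₂ ≡ s₁
      loop₁′ = trans (sym (final-++ s x₁ x₂)) loop₁

      skip₁ : ∀ ys → final s (x₁ ++ x₂ ++ ys) ≡ final s₁ ys
      skip₁ ys = begin
        final s (x₁ ++ x₂ ++ ys)  ≡⟨ final-++ s x₁ _ ⟩
        final s₁ (x₂ ++ ys)       ≡⟨ final-++ s₁ x₂ ys ⟩
        final (final s₁ x₂) ys    ≡⟨ cong (λ t → final t ys) loop₁′ ⟩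
        final s₁ ys ∎
        where open ≡-Reasoning

      loop₂′ : final s₂ y₂ ≡ s₂
      loop₂′ = begin
        final s₂ y₂               ≡⟨ final-++ s₁ z y₂ ⟨
        final s₁ (z ++ y₂)        ≡⟨ skip₁ (z ++ y₂) ⟨
        final s (x₁ ++ x₂ ++ z ++ y₂) ≡⟨ loop₂ ⟩
        final s (x₁ ++ x₂ ++ z)   ≡⟨ skip₁ z ⟩
        s₂ ∎
        where open ≡-Reasoning

      run-loop : ∀ {t} xs ys → final t xs ≡ t → run t (xs ++ ys) ≡ run t xs ++ run t ys
      run-loop {t} xs ys loop = trans (run-++ t xs ys) (cong (λ t′ → run t xs ++ run t′ ys) loop)

      run-long : run s (x₁ ++ x₂ ++ z ++ y₂ ++ y₁)
               ≡ run s x₁ ++ run s₁ x₂ ++ run s₁ z ++ run s₂ y₂ ++ run s₂ y₁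
      run-long = begin
        run s (x₁ ++ x₂ ++ z ++ y₂ ++ y₁)                     ≡⟨ run-++ s x₁ _ ⟩
        run s x₁ ++ run s₁ (x₂ ++ z ++ y₂ ++ y₁)              ≡⟨ cong (run s x₁ ++_) (run-loop x₂ _ loop₁′) ⟩
        run s x₁ ++ run s₁ x₂ ++ run s₁ (z ++ y₂ ++ y₁)       ≡⟨ cong (λ u → run s x₁ ++ run s₁ x₂ ++ u) (run-++ s₁ z _) ⟩
        run s x₁ ++ run s₁ x₂ ++ run s₁ z ++ run s₂ (y₂ ++ y₁)
          ≡⟨ cong (λ u → run s x₁ ++ run s₁ x₂ ++ run s₁ z ++ u) (run-loop y₂ y₁ loop₂′) ⟩
        run s x₁ ++ run s₁ x₂ ++ run s₁ z ++ run s₂ y₂ ++ run s₂ y₁ ∎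
        where open ≡-Reasoning

      run-short : run s (x₁ ++ z ++ y₁) ≡ run s x₁ ++ run s₁ z ++ run s₂ y₁
      run-short = trans (run-++ s x₁ _) (cong (run s x₁ ++_) (run-++ s₁ z y₁))

    final-delete-loops : final s (x₁ ++ z ++ y₁) ≡ final s (x₁ ++ x₂ ++ z ++ y₂ ++ y₁)
    final-delete-loops = begin
      final s (x₁ ++ z ++ y₁)              ≡⟨ final-++ s x₁ _ ⟩
      final s₁ (z ++ y₁)                   ≡⟨ final-++ s₁ z y₁ ⟩
      final s₂ y₁                          ≡⟨ cong (λ t → final t y₁) loop₂′ ⟨
      final (final s₂ y₂) y₁               ≡⟨ final-++ s₂ y₂ y₁ ⟨
      final s₂ (y₂ ++ y₁)                  ≡⟨ final-++ s₁ z _ ⟨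
      final s₁ (z ++ y₂ ++ y₁)             ≡⟨ skip₁ _ ⟨
      final s (x₁ ++ x₂ ++ z ++ y₂ ++ y₁) ∎
      where open ≡-Reasoning

    run-palindrome-delete-loops : length x₁ ≡ length y₁ → length x₂ ≡ length y₂ →
      reverse (run s (x₁ ++ x₂ ++ z ++ y₂ ++ y₁)) ≡ run s (x₁ ++ x₂ ++ z ++ y₂ ++ y₁) →
      reverse (run s (x₁ ++ z ++ y₁)) ≡ run s (x₁ ++ z ++ y₁)
    run-palindrome-delete-loops |x₁|≡|y₁| |x₂|≡|y₂| pal =
      subst (λ u → reverse u ≡ u) (sym run-short)
        (palindrome-delete (run s x₁) (run s₁ x₂) (run s₁ z) (run s₂ y₂) (run s₂ y₁)
          (trans (length-run s x₁) (trans |x₁|≡|y₁| (sym (length-run s₂ y₁))))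
          (trans (length-run s₁ x₂) (trans |x₂|≡|y₂| (sym (length-run s₂ y₂))))
          (subst (λ u → reverse u ≡ u) run-long pal))

  run-palindrome-delete-mirror : ∀ s (P Q R w R₂ Q′ pad : List A) →
    R ≡ w ++ R₂ → Q ++ w ≡ w ++ Q′ → length w ≡ length pad →
    final s (P ++ Q ++ w) ≡ final s (P ++ w) →
    final s (P ++ Q ++ R ++ reverse Q) ≡ final s (P ++ Q ++ R) →
    let long  = (P ++ Q ++ R ++ reverse Q ++ reverse P) ++ pad
        short = (P ++ R ++ reverse P) ++ pad
    in reverse (run s long) ≡ run s long →
       reverse (run s short) ≡ run s short × final s short ≡ final s long
  -- The padded input is cut as (P ++ w) Q′ R₂ Qʳ (Pʳ ++ pad), with Q′ the block Q
  -- shifted past w; since |P ++ w| = |Pʳ ++ pad| the deleted blocks Q′ and Qʳ then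
  -- sit at mirror positions.
  run-palindrome-delete-mirror s P Q R w R₂ Q′ pad R≡ Qw≡ |w|≡|pad| loop₁ loop₂ pal =
    subst Palindromic (sym short≡) (run-palindrome-delete-loops s x₁ Q′ R₂ (reverse Q) y₁ loop₁′ loop₂′
      |x₁|≡|y₁| |Q′|≡|Qʳ| (subst Palindromic long≡ pal)) ,
    trans (cong (final s) short≡) (trans (final-delete-loops s x₁ Q′ R₂ (reverse Q) y₁ loop₁′ loop₂′)
      (cong (final s) (sym long≡)))
    where
    open ≡-Reasoning
    Palindromic : List A → Set _
    Palindromic xs = reverse (run s xs) ≡ run s xs
    x₁ y₁ : List A
    x₁ = P ++ w
    y₁ = reverse P ++ pad
    through-R : ∀ U → x₁ ++ Q′ ++ R₂ ++ U ≡ P ++ Q ++ R ++ U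
    through-R U = begin
      (P ++ w) ++ Q′ ++ R₂ ++ U    ≡⟨ ++-assoc P w _ ⟩
      P ++ w ++ Q′ ++ R₂ ++ U      ≡⟨ cong (P ++_) (++-assoc w Q′ _) ⟨
      P ++ (w ++ Q′) ++ R₂ ++ U    ≡⟨ cong (λ V → P ++ V ++ R₂ ++ U) Qw≡ ⟨
      P ++ (Q ++ w) ++ R₂ ++ U     ≡⟨ cong (P ++_) (++-assoc Q w _) ⟩
      P ++ Q ++ w ++ R₂ ++ U       ≡⟨ cong (λ V → P ++ Q ++ V) (++-assoc w R₂ U) ⟨
      P ++ Q ++ (w ++ R₂) ++ U     ≡⟨ cong (λ V → P ++ Q ++ V ++ U) R≡ ⟨
      P ++ Q ++ R ++ U ∎
    long≡ : (P ++ Q ++ R ++ reverse Q ++ reverse P) ++ pad ≡ x₁ ++ Q′ ++ R₂ ++ reverse Q ++ y₁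
    long≡ = trans (++-assoc₅ P Q R (reverse Q) (reverse P) pad) (sym (through-R (reverse Q ++ y₁)))
    short≡ : (P ++ R ++ reverse P) ++ pad ≡ x₁ ++ R₂ ++ y₁
    short≡ = begin
      (P ++ R ++ reverse P) ++ pad  ≡⟨ ++-assoc P _ pad ⟩
      P ++ (R ++ reverse P) ++ pad  ≡⟨ cong (P ++_) (++-assoc R _ pad) ⟩
      P ++ R ++ y₁                  ≡⟨ cong (λ V → P ++ V ++ y₁) R≡ ⟩
      P ++ (w ++ R₂) ++ y₁          ≡⟨ cong (P ++_) (++-assoc w R₂ y₁) ⟩
      P ++ w ++ R₂ ++ y₁            ≡⟨ ++-assoc P w _ ⟨
      x₁ ++ R₂ ++ y₁ ∎
    loop₁′ : final s (x₁ ++ Q′) ≡ final s x₁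
    loop₁′ = trans (cong (final s) (begin
      (P ++ w) ++ Q′   ≡⟨ ++-assoc P w Q′ ⟩
      P ++ w ++ Q′     ≡⟨ cong (P ++_) Qw≡ ⟨
      P ++ Q ++ w ∎)) loop₁
    loop₂′ : final s (x₁ ++ Q′ ++ R₂ ++ reverse Q) ≡ final s (x₁ ++ Q′ ++ R₂)
    loop₂′ = trans (cong (final s) (through-R (reverse Q)))
      (trans loop₂ (cong (final s) (sym (subst₂ (λ U V → x₁ ++ Q′ ++ U ≡ P ++ Q ++ V)
        (++-identityʳ R₂) (++-identityʳ R) (through-R [])))))
    |x₁|≡|y₁| : length x₁ ≡ length y₁
    |x₁|≡|y₁| = trans (length-++ P) (trans (cong₂ _+_ (sym (length-reverse P)) |w|≡|pad|) (sym (length-++ (reverse P))))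
    |Q′|≡|Qʳ| : length Q′ ≡ length (reverse Q)
    |Q′|≡|Qʳ| = +-cancelˡ-≡ (length w) _ _ (begin
      length w + length Q′  ≡⟨ length-++ w ⟨
      length (w ++ Q′)      ≡⟨ cong length Qw≡ ⟨
      length (Q ++ w)       ≡⟨ length-++ Q ⟩
      length Q + length w   ≡⟨ +-comm (length Q) _ ⟩
      length w + length Q   ≡⟨ cong (length w +_) (length-reverse Q) ⟨
      length w + length (reverse Q) ∎)

module Base (k₀ : ℕ) where

  k : ℕ
  k = 2 + k₀

  1<k : 1 < k
  1<k = s≤s (s≤s z≤n)

  fromDigits : List ℕ → ℕ
  fromDigits []       = 0
  fromDigits (x ∷ xs) = x + fromDigits xs * k

  fromDigits-++ : ∀ xs ys → fromDigits (xs ++ ys) ≡ fromDigits xs + fromDigits ys * k ^ length xs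
  fromDigits-++ []       ys = sym (*-identityʳ (fromDigits ys))
  fromDigits-++ (x ∷ xs) ys = begin
    x + fromDigits (xs ++ ys) * k                             ≡⟨ cong (λ v → x + v * k) (fromDigits-++ xs ys) ⟩
    x + (fromDigits xs + fromDigits ys * k ^ length xs) * k   ≡⟨ solve-∀′ x (fromDigits xs) (fromDigits ys) (k ^ length xs) k ⟩
    x + fromDigits xs * k + fromDigits ys * (k * k ^ length xs) ∎
    where
    open ≡-Reasoning
    solve-∀′ : ∀ x a b p k → x + (a + b * p) * k ≡ x + a * k + b * (k * p)
    solve-∀′ = solve-∀

  fromDigits-replicate-0 : ∀ n → fromDigits (replicate n 0) ≡ 0
  fromDigits-replicate-0 zero    = refl
  fromDigits-replicate-0 (suc n) = cong (_* k) (fromDigits-replicate-0 n)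

  fromDigits-++-zeros : ∀ xs n → fromDigits (xs ++ replicate n 0) ≡ fromDigits xs
  fromDigits-++-zeros xs n = begin
    fromDigits (xs ++ replicate n 0)                                  ≡⟨ fromDigits-++ xs _ ⟩
    fromDigits xs + fromDigits (replicate n 0) * k ^ length xs        ≡⟨ cong (λ v → fromDigits xs + v * k ^ length xs) (fromDigits-replicate-0 n) ⟩
    fromDigits xs + 0                                                 ≡⟨ +-identityʳ _ ⟩
    fromDigits xs ∎
    where open ≡-Reasoning

  fromDigits<k^length : ∀ {xs} → All (_< k) xs → fromDigits xs < k ^ length xs
  fromDigits<k^length {[]}     []           = s≤s z≤n
  fromDigits<k^length {x ∷ xs} (x<k ∷ xs<k) = begin-strict
    x + fromDigits xs * k     <⟨ +-monoˡ-< _ x<k ⟩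
    k + fromDigits xs * k     ≡⟨⟩
    suc (fromDigits xs) * k   ≤⟨ *-monoˡ-≤ k (fromDigits<k^length xs<k) ⟩
    k ^ length xs * k         ≡⟨ *-comm (k ^ length xs) k ⟩
    k ^ length (x ∷ xs) ∎
    where open ≤-Reasoning

  [x+wk]%k≡x : ∀ {x} w → x < k → (x + w * k) % k ≡ x
  [x+wk]%k≡x {x} w x<k = trans ([m+kn]%n≡m%n x w k) (m<n⇒m%n≡m x<k)

  [x+wk]/k≡w : ∀ {x} w → x < k → (x + w * k) / k ≡ w
  [x+wk]/k≡w {x} w x<k = begin
    (x + w * k) / k    ≡⟨ +-distrib-/-∣ʳ x (n∣m*n w) ⟩
    x / k + w * k / k  ≡⟨ cong₂ _+_ (m<n⇒m/n≡0 x<k) (m*n/n≡m w k) ⟩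
    w ∎
    where open ≡-Reasoning

  fromDigits-injective : ∀ {xs ys} → All (_< k) xs → All (_< k) ys → length xs ≡ length ys →
    fromDigits xs ≡ fromDigits ys → xs ≡ ys
  fromDigits-injective {[]}     {[]}     _            _            _   _  = refl
  fromDigits-injective {x ∷ xs} {y ∷ ys} (x<k ∷ xs<k) (y<k ∷ ys<k) len eq = cong₂ _∷_
    (trans (sym ([x+wk]%k≡x (fromDigits xs) x<k)) (trans (cong (_% k) eq) ([x+wk]%k≡x (fromDigits ys) y<k)))
    (fromDigits-injective xs<k ys<k (suc-injective len)
      (trans (sym ([x+wk]/k≡w (fromDigits xs) x<k)) (trans (cong (_/ k) eq) ([x+wk]/k≡w (fromDigits ys) y<k))))

  n/k<n : ∀ n → suc n / k < suc n
  n/k<n n = m/n<m (suc n) k 1<k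

  digitsFuel-irrelevant : ∀ {f g n} → n ≤ f → n ≤ g → digitsFuel f k n ≡ digitsFuel g k n
  digitsFuel-irrelevant {zero}  {zero}  z≤n _ = refl
  digitsFuel-irrelevant {zero}  {suc g} z≤n _ = refl
  digitsFuel-irrelevant {suc f} {zero}  z≤n _ = refl
  digitsFuel-irrelevant {suc f} {suc g} z≤n _ = refl
  digitsFuel-irrelevant {suc f} {suc g} {suc n} (s≤s n≤f) (s≤s n≤g) =
    cong (suc n % k ∷_) (digitsFuel-irrelevant (≤-trans q≤n n≤f) (≤-trans q≤n n≤g))
    where
    q≤n : suc n / k ≤ n
    q≤n = <⇒≤pred (n/k<n n)

  digits-suc : ∀ n → digits k (suc n) ≡ suc n % k ∷ digits k (suc n / k)
  digits-suc n = cong (suc n % k ∷_) (digitsFuel-irrelevant (<⇒≤pred (n/k<n n)) ≤-refl)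

  digits-∷ : ∀ {x} w → x < k → 0 < x + w * k → digits k (x + w * k) ≡ x ∷ digits k w
  digits-∷ {x} w x<k pos with x + w * k in eq
  ... | suc n = trans (digits-suc n)
    (cong₂ (λ y v → y ∷ digits k v)
      (trans (cong (_% k) (sym eq)) ([x+wk]%k≡x w x<k))
      (trans (cong (_/ k) (sym eq)) ([x+wk]/k≡w w x<k)))

  fromDigits-digitsFuel : ∀ f n → n ≤ f → fromDigits (digitsFuel f k n) ≡ n
  fromDigits-digitsFuel zero    zero    _         = refl
  fromDigits-digitsFuel (suc f) zero    _         = refl
  fromDigits-digitsFuel (suc f) (suc n) (s≤s n≤f) = begin
    suc n % k + fromDigits (digitsFuel f k (suc n / k)) * k
      ≡⟨ cong (λ v → suc n % k + v * k) (fromDigits-digitsFuel f _ (≤-trans (<⇒≤pred (n/k<n n)) n≤f)) ⟩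
    suc n % k + suc n / k * k
      ≡⟨ m≡m%n+[m/n]*n (suc n) k ⟨
    suc n ∎
    where open ≡-Reasoning

  fromDigits-digits : ∀ n → fromDigits (digits k n) ≡ n
  fromDigits-digits n = fromDigits-digitsFuel n n ≤-refl

  data Canonical : List ℕ → Set where
    []   : Canonical []
    last : ∀ {x} → x < k → 0 < x → Canonical [ x ]
    _∷_  : ∀ {x y ys} → x < k → Canonical (y ∷ ys) → Canonical (x ∷ y ∷ ys)

  Canonical⇒All : ∀ {xs} → Canonical xs → All (_< k) xs
  Canonical⇒All []          = []
  Canonical⇒All (last x<k _) = x<k ∷ []
  Canonical⇒All (x<k ∷ c)   = x<k ∷ Canonical⇒All c

  k^length≤fromDigits : ∀ {x xs} → Canonical (x ∷ xs) → k ^ length xs ≤ fromDigits (x ∷ xs)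
  k^length≤fromDigits {x} (last _ 0<x) = ≤-trans 0<x (m≤m+n x 0)
  k^length≤fromDigits {x} {y ∷ ys} (_ ∷ c) = begin
    k * k ^ length ys          ≡⟨ *-comm k (k ^ length ys) ⟩
    k ^ length ys * k          ≤⟨ *-monoˡ-≤ k (k^length≤fromDigits c) ⟩
    fromDigits (y ∷ ys) * k    ≤⟨ m≤n+m _ x ⟩
    x + fromDigits (y ∷ ys) * k ∎
    where open ≤-Reasoning

  fromDigits-positive : ∀ {x xs} → Canonical (x ∷ xs) → 0 < fromDigits (x ∷ xs)
  fromDigits-positive {xs = xs} c = <-≤-trans (m^n>0 k (length xs)) (k^length≤fromDigits c)

  canonical-∷ : ∀ {x xs} → x < k → Canonical xs → 0 < fromDigits (x ∷ xs) → Canonical (x ∷ xs)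
  canonical-∷ {x} x<k []           pos = last x<k (subst (0 <_) (+-identityʳ x) pos)
  canonical-∷     x<k c@(last _ _) _   = x<k ∷ c
  canonical-∷     x<k c@(_ ∷ _)    _   = x<k ∷ c

  canonical-digitsFuel : ∀ f n → n ≤ f → Canonical (digitsFuel f k n)
  canonical-digitsFuel zero    zero    _         = []
  canonical-digitsFuel (suc f) zero    _         = []
  canonical-digitsFuel (suc f) (suc n) (s≤s n≤f) =
    canonical-∷ (m%n<n (suc n) k)
      (canonical-digitsFuel f _ (≤-trans (<⇒≤pred (n/k<n n)) n≤f))
      (subst (0 <_) (sym (fromDigits-digitsFuel (suc f) (suc n) (s≤s n≤f))) (s≤s z≤n))

  canonical-digits : ∀ n → Canonical (digits k n)
  canonical-digits n = canonical-digitsFuel n n ≤-refl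

  digits-fromDigits : ∀ {xs} → Canonical xs → digits k (fromDigits xs) ≡ xs
  digits-fromDigits []               = refl
  digits-fromDigits (last x<k 0<x)   = digits-∷ 0 x<k (≤-trans 0<x (m≤m+n _ 0))
  digits-fromDigits c@(x<k ∷ c′)     =
    trans (digits-∷ _ x<k (fromDigits-positive c)) (cong (_ ∷_) (digits-fromDigits c′))

  canonical-∷ʳ : ∀ {xs x} → All (_< k) xs → x < k → 0 < x → Canonical (xs ∷ʳ x)
  canonical-∷ʳ []                  x<k 0<x = last x<k 0<x
  canonical-∷ʳ (y<k ∷ [])          x<k 0<x = y<k ∷ last x<k 0<x
  canonical-∷ʳ (y<k ∷ z<k ∷ zs<k)  x<k 0<x = y<k ∷ canonical-∷ʳ (z<k ∷ zs<k) x<k 0<x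

  canonical-∷ʳ⁻ : ∀ xs {x} → Canonical (xs ∷ʳ x) → 0 < x
  canonical-∷ʳ⁻ []           (last _ 0<x) = 0<x
  canonical-∷ʳ⁻ (_ ∷ [])     (_ ∷ c)      = canonical-∷ʳ⁻ [] c
  canonical-∷ʳ⁻ (_ ∷ z ∷ zs) (_ ∷ c)      = canonical-∷ʳ⁻ (z ∷ zs) c

  palindrome-∷ʳ : ∀ {x xs} → Palindrome (x ∷ xs) → x ∷ xs ≡ reverse xs ∷ʳ x
  palindrome-∷ʳ {x} {xs} pal = trans (sym pal) (unfold-reverse x xs)

  canonical-palindrome-head : ∀ {x xs} → Canonical (x ∷ xs) → Palindrome (x ∷ xs) → 0 < x
  canonical-palindrome-head {xs = xs} c pal = canonical-∷ʳ⁻ (reverse xs) (subst Canonical (palindrome-∷ʳ pal) c)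

  palindrome-canonical : ∀ {x xs} → All (_< k) (x ∷ xs) → 0 < x → Palindrome (x ∷ xs) → Canonical (x ∷ xs)
  palindrome-canonical {xs = xs} all@(x<k ∷ _) 0<x pal = subst Canonical (sym (palindrome-∷ʳ pal))
    (canonical-∷ʳ (++⁻ˡ (reverse xs) (subst (All (_< k)) (palindrome-∷ʳ pal) all)) x<k 0<x)

  canonical-palindrome-delete : ∀ P Q R → 0 < length P →
    let xs = P ++ Q ++ R ++ reverse Q ++ reverse P
        ys = P ++ R ++ reverse P
    in Canonical xs → Palindrome xs → Canonical ys × Palindrome ys
  canonical-palindrome-delete P@(_ ∷ _) Q R _ can pal =
    palindrome-canonical ys<k (canonical-palindrome-head can pal) pal′ , pal′
    where
    pal′ : Palindrome (P ++ R ++ reverse P)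
    pal′ = palindrome-delete P Q R (reverse Q) (reverse P) (sym (length-reverse P)) (sym (length-reverse Q)) pal
    xs<k : All (_< k) (P ++ Q ++ R ++ reverse Q ++ reverse P)
    xs<k = Canonical⇒All can
    rest<k : All (_< k) (R ++ reverse Q ++ reverse P)
    rest<k = ++⁻ʳ Q (++⁻ʳ P xs<k)
    ys<k : All (_< k) (P ++ R ++ reverse P)
    ys<k = ++⁺ (++⁻ˡ P xs<k) (++⁺ (++⁻ˡ R rest<k) (++⁻ʳ (reverse Q) (++⁻ʳ R rest<k)))

  k^n≤fromDigits : ∀ {n xs} → Canonical xs → n < length xs → k ^ n ≤ fromDigits xs
  k^n≤fromDigits {n} {_ ∷ xs} c (s≤s n≤) = ≤-trans (^-monoʳ-≤ k n≤) (k^length≤fromDigits c)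

  fromDigits-<-length : ∀ {xs ys} → All (_< k) xs → Canonical ys → length xs < length ys →
    fromDigits xs < fromDigits ys
  fromDigits-<-length xs<k c len = <-≤-trans (fromDigits<k^length xs<k) (k^n≤fromDigits c len)

  n<k^n : ∀ n → n < k ^ n
  n<k^n zero    = s≤s z≤n
  n<k^n (suc n) = ≤-<-trans (n<k^n n) (^-monoʳ-< k 1<k (n<1+n n))

  leastExpFrom-spec : ∀ m n f e → n ≤ k ^ (m * (e + f)) → n ≤ k ^ (m * leastExpFrom f k m n e)
  leastExpFrom-spec m n zero    e n≤ = subst (λ i → n ≤ k ^ (m * i)) (+-identityʳ e) n≤
  leastExpFrom-spec m n (suc f) e n≤ with n ≤? k ^ (m * e)
  ... | yes n≤k^me = n≤k^me
  ... | no  _      = leastExpFrom-spec m n f (suc e) (subst (λ i → n ≤ k ^ (m * i)) (+-suc e f) n≤)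

  ceilLog-spec : ∀ n → n ≤ k ^ ceilLog k n
  ceilLog-spec n = subst (λ i → n ≤ k ^ i) (*-identityˡ (ceilLog k n))
    (leastExpFrom-spec 1 n n 0 (subst (λ i → n ≤ k ^ i) (sym (*-identityˡ n)) (<⇒≤ (n<k^n n))))

  module Times (N : ℕ) where

    carry : ℕ → ℕ → ℕ
    carry c x = (N * x + c) / k

    digit : ℕ → ℕ → ℕ
    digit c x = (N * x + c) % k

    open Transducer carry digit public

    fromDigits-run : ∀ c xs → fromDigits (run c xs) + final c xs * k ^ length xs ≡ N * fromDigits xs + c
    fromDigits-run c []       = trans (*-identityʳ c) (cong (_+ c) (sym (*-zeroʳ N)))
    fromDigits-run c (x ∷ xs) = begin
      r + fromDigits (run q xs) * k + final q xs * (k * k ^ length xs)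
        ≡⟨ solve-∀₁ r (fromDigits (run q xs)) (final q xs) k (k ^ length xs) ⟩
      r + (fromDigits (run q xs) + final q xs * k ^ length xs) * k
        ≡⟨ cong (λ v → r + v * k) (fromDigits-run q xs) ⟩
      r + (N * fromDigits xs + q) * k
        ≡⟨ solve-∀₂ r N (fromDigits xs) q k ⟩
      (r + q * k) + N * fromDigits xs * k
        ≡⟨ cong (_+ N * fromDigits xs * k) (m≡m%n+[m/n]*n (N * x + c) k) ⟨
      N * x + c + N * fromDigits xs * k
        ≡⟨ solve-∀₃ N x c (fromDigits xs) k ⟩
      N * (x + fromDigits xs * k) + c ∎
      where
      open ≡-Reasoning
      r q : ℕ
      r = digit c x
      q = carry c x
      solve-∀₁ : ∀ r a f k p → r + a * k + f * (k * p) ≡ r + (a + f * p) * k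
      solve-∀₁ = solve-∀
      solve-∀₂ : ∀ r N v q k → r + (N * v + q) * k ≡ (r + q * k) + N * v * k
      solve-∀₂ = solve-∀
      solve-∀₃ : ∀ N x c v k → N * x + c + N * v * k ≡ N * (x + v * k) + c
      solve-∀₃ = solve-∀

    fromDigits-run-exact : ∀ xs → final 0 xs ≡ 0 → fromDigits (run 0 xs) ≡ N * fromDigits xs
    fromDigits-run-exact xs final≡0 = begin
      fromDigits (run 0 xs)                                   ≡⟨ +-identityʳ _ ⟨
      fromDigits (run 0 xs) + 0 * k ^ length xs               ≡⟨ cong (λ f → fromDigits (run 0 xs) + f * k ^ length xs) final≡0 ⟨
      fromDigits (run 0 xs) + final 0 xs * k ^ length xs      ≡⟨ fromDigits-run 0 xs ⟩
      N * fromDigits xs + 0                                   ≡⟨ +-identityʳ _ ⟩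
      N * fromDigits xs ∎
      where open ≡-Reasoning

    run-digits : ∀ c xs → All (_< k) (run c xs)
    run-digits c []       = []
    run-digits c (x ∷ xs) = m%n<n (N * x + c) k ∷ run-digits (carry c x) xs

    final<N : ∀ {c xs} → c < N → All (_< k) xs → final c xs < N
    final<N c<N []                    = c<N
    final<N {c} c<N (_∷_ {x} x<k xs<k) = final<N (m<n*o⇒m/o<n (begin-strict
      N * x + c     <⟨ +-monoʳ-< (N * x) c<N ⟩
      N * x + N     ≡⟨ +-comm (N * x) N ⟩
      N + N * x     ≡⟨ *-suc N x ⟨
      N * suc x     ≤⟨ *-monoʳ-≤ N x<k ⟩
      N * k ∎)) xs<k
      where open ≤-Reasoning

    run-unique : ∀ {xs ys} → All (_< k) ys → length ys ≡ length xs → fromDigits ys ≡ N * fromDigits xs →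
      run 0 xs ≡ ys × final 0 xs ≡ 0
    run-unique {xs} {ys} ys<k len eq = fromDigits-injective (run-digits 0 xs) ys<k (trans (length-run 0 xs) (sym len))
        (trans (sym (+-identityʳ _)) (trans (cong (λ f → v + f * p) (sym final≡0)) value)) , final≡0
      where
      v p : ℕ
      v = fromDigits (run 0 xs)
      p = k ^ length xs
      value : v + final 0 xs * p ≡ fromDigits ys
      value = trans (fromDigits-run 0 xs) (trans (+-identityʳ _) (sym eq))
      final≡0 : final 0 xs ≡ 0
      final≡0 with final 0 xs | value
      ... | zero  | _  = refl
      ... | suc f | value′ = contradiction (fromDigits<k^length ys<k) (≤⇒≯ (begin
        k ^ length ys     ≡⟨ cong (k ^_) len ⟩
        p                 ≤⟨ m≤m+n p (f * p) ⟩
        suc f * p         ≤⟨ m≤n+m _ v ⟩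
        v + suc f * p     ≡⟨ value′ ⟩
        fromDigits ys ∎))
        where open ≤-Reasoning

    canonical-palindromes-goodPair : ∀ {a as b bs} → Canonical (a ∷ as) → Canonical (b ∷ bs) →
      Palindrome (a ∷ as) → Palindrome (b ∷ bs) → fromDigits (a ∷ as) ≡ N * fromDigits (b ∷ bs) →
      GoodPair k N (fromDigits (a ∷ as)) (fromDigits (b ∷ bs))
    canonical-palindromes-goodPair ca cb pa pb eq =
      fromDigits-positive ca , fromDigits-positive cb ,
      subst Palindrome (sym (digits-fromDigits ca)) pa ,
      subst Palindrome (sym (digits-fromDigits cb)) pb , eq

module PalindromicPair (k₀ N : ℕ) .{{_ : NonZero N}} {A B : ℕ}
         (palα : Palindrome (digits (2 + k₀) A)) (palβ : Palindrome (digits (2 + k₀) B))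
         (A≡NB : A ≡ N * B) where

  open Base k₀
  open Times N

  α β : List ℕ
  α = digits k A
  β = digits k B

  L M d : ℕ
  L = length α
  M = length β
  d = L ∸ M

  pad : List ℕ
  pad = replicate d 0

  canα : Canonical α
  canα = canonical-digits A

  canβ : Canonical β
  canβ = canonical-digits B

  α<k : All (_< k) α
  α<k = Canonical⇒All canα

  β<k : All (_< k) β
  β<k = Canonical⇒All canβ

  M≤L : M ≤ L
  M≤L = ≮⇒≥ λ L<M → <⇒≱ (fromDigits-<-length α<k canβ L<M) (begin
    fromDigits β   ≡⟨ fromDigits-digits B ⟩
    B              ≤⟨ m≤n*m B N ⟩
    N * B          ≡⟨ A≡NB ⟨
    A              ≡⟨ fromDigits-digits A ⟨
    fromDigits α ∎)
    where open ≤-Reasoning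

  L≤c+M : L ≤ ceilLog k N + M
  L≤c+M = ≮⇒≥ λ c+M<L → <-irrefl refl (begin-strict
    k ^ (c + M)         ≤⟨ k^n≤fromDigits canα c+M<L ⟩
    fromDigits α        ≡⟨ fromDigits-digits A ⟩
    A                   ≡⟨ A≡NB ⟩
    N * B               ≡⟨ cong (N *_) (fromDigits-digits B) ⟨
    N * fromDigits β    <⟨ *-monoʳ-< N (fromDigits<k^length β<k) ⟩
    N * k ^ M           ≤⟨ *-monoˡ-≤ (k ^ M) (ceilLog-spec N) ⟩
    k ^ c * k ^ M       ≡⟨ ^-distribˡ-+-* k c M ⟨
    k ^ (c + M) ∎)
    where
    open ≤-Reasoning
    c : ℕ
    c = ceilLog k N

  M+d≡L : M + d ≡ L
  M+d≡L = m+[n∸m]≡n M≤L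

  d≤ceilLog : d ≤ ceilLog k N
  d≤ceilLog = m≤n+o⇒m∸n≤o L M (subst (L ≤_) (+-comm (ceilLog k N) M) L≤c+M)

  run-β : run 0 (β ++ pad) ≡ α × final 0 (β ++ pad) ≡ 0
  run-β = run-unique α<k length-α fromDigits-α
    where
    open ≡-Reasoning
    length-α : L ≡ length (β ++ pad)
    length-α = begin
      L                       ≡⟨ M+d≡L ⟨
      M + d                   ≡⟨ cong (M +_) (length-replicate d) ⟨
      M + length pad          ≡⟨ length-++ β ⟨
      length (β ++ pad) ∎
    fromDigits-α : fromDigits α ≡ N * fromDigits (β ++ pad)
    fromDigits-α = begin
      fromDigits α               ≡⟨ fromDigits-digits A ⟩
      A                          ≡⟨ A≡NB ⟩
      N * B                      ≡⟨ cong (N *_) (fromDigits-digits B) ⟨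
      N * fromDigits β           ≡⟨ cong (N *_) (fromDigits-++-zeros β d) ⟨
      N * fromDigits (β ++ pad) ∎

  smaller-pair : ∀ P Q R w R₂ Q′ → 0 < length P → 0 < length Q →
    β ≡ P ++ Q ++ R ++ reverse Q ++ reverse P → R ≡ w ++ R₂ → Q ++ w ≡ w ++ Q′ → length w ≡ d →
    final 0 (P ++ Q ++ w) ≡ final 0 (P ++ w) →
    final 0 (P ++ Q ++ R ++ reverse Q) ≡ final 0 (P ++ Q ++ R) →
    ∃₂ λ A′ B′ → GoodPair k N A′ B′ × A′ < A
  smaller-pair P@(_ ∷ _) Q R w R₂ Q′ 0<|P| 0<|Q| β≡ R≡ Qw≡ |w|≡d loop₁ loop₂ =
    fromDigits α″ , fromDigits β″ ,
    canonical-palindromes-goodPair canα″ canβ″ palα″ palβ″ fromDigits-α″ ,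
    subst (fromDigits α″ <_) (fromDigits-digits A) (fromDigits-<-length (run-digits 0 (β″ ++ pad)) canα |α″|<L)
    where
    β₅ β″ α″ : List ℕ
    β₅ = P ++ Q ++ R ++ reverse Q ++ reverse P
    β″ = P ++ R ++ reverse P
    α″ = run 0 (β″ ++ pad)
    α≡ : α ≡ run 0 (β₅ ++ pad)
    α≡ = trans (sym (proj₁ run-β)) (cong (λ xs → run 0 (xs ++ pad)) β≡)
    deleted : Palindrome α″ × final 0 (β″ ++ pad) ≡ final 0 (β₅ ++ pad)
    deleted = run-palindrome-delete-mirror 0 P Q R w R₂ Q′ pad R≡ Qw≡
      (trans |w|≡d (sym (length-replicate d))) loop₁ loop₂ (subst Palindrome α≡ palα)
    palα″ : Palindrome α″
    palα″ = proj₁ deleted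
    β″-digits : Canonical β″ × Palindrome β″
    β″-digits = canonical-palindrome-delete P Q R 0<|P| (subst Canonical β≡ canβ) (subst Palindrome β≡ palβ)
    canβ″ : Canonical β″
    canβ″ = proj₁ β″-digits
    palβ″ : Palindrome β″
    palβ″ = proj₂ β″-digits
    canα″ : Canonical α″
    canα″ = palindrome-canonical (run-digits 0 (β″ ++ pad))
      (canonical-palindrome-head (subst Canonical α≡ canα) (subst Palindrome α≡ palα)) palα″
    fromDigits-α″ : fromDigits α″ ≡ N * fromDigits β″
    fromDigits-α″ = begin
      fromDigits α″                ≡⟨ fromDigits-run-exact (β″ ++ pad) (trans (proj₂ deleted)
                                        (trans (cong (λ xs → final 0 (xs ++ pad)) (sym β≡)) (proj₂ run-β))) ⟩
      N * fromDigits (β″ ++ pad)   ≡⟨ cong (N *_) (fromDigits-++-zeros β″ d) ⟩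
      N * fromDigits β″ ∎
      where open ≡-Reasoning
    |α″|<L : length α″ < L
    |α″|<L = begin-strict
      length α″                                   ≡⟨ length-run 0 (β″ ++ pad) ⟩
      length (β″ ++ pad)                          ≡⟨ length-++ β″ ⟩
      length β″ + length pad                      <⟨ +-monoˡ-< (length pad) (m<m+n (length β″) (≤-trans 0<|Q| (m≤m+n _ _))) ⟩
      length β″ + (length Q + length (reverse Q)) + length pad
                                                  ≡⟨ cong (_+ length pad) (length-delete P Q R (reverse Q) (reverse P)) ⟨
      length β₅ + length pad                      ≡⟨ cong (λ xs → length xs + length pad) β≡ ⟨
      M + length pad                              ≡⟨ cong (M +_) (length-replicate d) ⟩
      M + d                                       ≡⟨ M+d≡L ⟩
      L ∎
      where open ≤-Reasoning

  window : ℕ → List ℕ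
  window m = take d (trim m β)

  leftCarry : ℕ → ℕ
  leftCarry m = final 0 (take m β ++ window m)

  rightCarry : ℕ → ℕ
  rightCarry m = final 0 (take m β ++ trim m β)

  length-take-β : ∀ {m} → m ≤ M → length (take m β) ≡ m
  length-take-β {m} m≤M = trans (length-take m β) (m≤n⇒m⊓n≡m m≤M)

  d≤length-trim : ∀ m → m + m + d ≤ M → d ≤ length (trim m β)
  d≤length-trim m bound = begin
    d                              ≤⟨ m+n≤o⇒m≤o∸n d (subst (_≤ M) (+-comm (m + m) d) bound) ⟩
    M ∸ (m + m)                    ≡⟨ ∸-+-assoc M m m ⟨
    M ∸ m ∸ m                      ≡⟨ cong (_∸ m) (length-take-β (m∸n≤m M m)) ⟨
    length (take (M ∸ m) β) ∸ m    ≡⟨ length-drop m (take (M ∸ m) β) ⟨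
    length (trim m β) ∎
    where open ≤-Reasoning

  length-window : ∀ m → m + m + d ≤ M → length (window m) ≡ d
  length-window m bound = trans (length-take d (trim m β)) (m≤n⇒m⊓n≡m (d≤length-trim m bound))

  collision⇒smaller-pair : ∀ m₁ m₂ → 0 < m₁ → m₁ < m₂ → m₂ + m₂ + d ≤ M →
    leftCarry m₁ ≡ leftCarry m₂ → rightCarry m₁ ≡ rightCarry m₂ → window m₁ ≡ window m₂ →
    ∃₂ λ A′ B′ → GoodPair k N A′ B′ × A′ < A
  collision⇒smaller-pair m₁ m₂ 0<m₁ m₁<m₂ bound left right same-window =
    smaller-pair P Q R w R₂ Q′ 0<|P| 0<|Q| β≡ R≡ Qw≡ (length-window m₂ bound) loop₁ loop₂
    where
    open ≡-Reasoning
    T P Q R w R₂ Q′ : List ℕ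
    T = take m₂ β
    P = take m₁ β
    Q = drop m₁ T
    R = trim m₂ β
    w = window m₂
    R₂ = drop d R
    Q′ = drop d (Q ++ w)
    m₁≤m₂ : m₁ ≤ m₂
    m₁≤m₂ = <⇒≤ m₁<m₂
    m₂+m₂≤M : m₂ + m₂ ≤ M
    m₂+m₂≤M = m+n≤o⇒m≤o (m₂ + m₂) bound
    m₂≤M : m₂ ≤ M
    m₂≤M = m+n≤o⇒m≤o m₂ m₂+m₂≤M
    0<|P| : 0 < length P
    0<|P| = subst (0 <_) (sym (length-take-β (≤-trans m₁≤m₂ m₂≤M))) 0<m₁
    0<|Q| : 0 < length Q
    0<|Q| = subst (0 <_) (sym (trans (length-drop m₁ T) (cong (_∸ m₁) (length-take-β m₂≤M)))) (m<n⇒0<n∸m m₁<m₂)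
    β≡ : β ≡ P ++ Q ++ R ++ reverse Q ++ reverse P
    β≡ = proj₁ (palindrome-layers m₁ m₂ β palβ m₁≤m₂ m₂+m₂≤M)
    trim₁ : trim m₁ β ≡ Q ++ R ++ reverse Q
    trim₁ = proj₂ (palindrome-layers m₁ m₂ β palβ m₁≤m₂ m₂+m₂≤M)
    T≡ : T ≡ P ++ Q
    T≡ = take-prefix β m₁≤m₂
    R≡ : R ≡ w ++ R₂
    R≡ = sym (take++drop≡id d R)
    Qw≡ : Q ++ w ≡ w ++ Q′
    Qw≡ = take-shift d Q R (reverse Q) (d≤length-trim m₂ bound) (trans (cong (take d) (sym trim₁)) same-window)
    loop₁ : final 0 (P ++ Q ++ w) ≡ final 0 (P ++ w)
    loop₁ = begin
      final 0 (P ++ Q ++ w)        ≡⟨ cong (final 0) (++-assoc P Q w) ⟨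
      final 0 ((P ++ Q) ++ w)      ≡⟨ cong (λ U → final 0 (U ++ w)) T≡ ⟨
      leftCarry m₂                 ≡⟨ left ⟨
      leftCarry m₁                 ≡⟨ cong (λ U → final 0 (P ++ U)) same-window ⟩
      final 0 (P ++ w) ∎
    loop₂ : final 0 (P ++ Q ++ R ++ reverse Q) ≡ final 0 (P ++ Q ++ R)
    loop₂ = begin
      final 0 (P ++ Q ++ R ++ reverse Q) ≡⟨ cong (λ U → final 0 (P ++ U)) trim₁ ⟨
      rightCarry m₁                      ≡⟨ right ⟩
      rightCarry m₂                      ≡⟨ cong (λ U → final 0 (U ++ R)) T≡ ⟩
      final 0 ((P ++ Q) ++ R)            ≡⟨ cong (final 0) (++-assoc P Q R) ⟩
      final 0 (P ++ Q ++ R) ∎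

  K : ℕ
  K = N * (N * k ^ d)

  trim<k : ∀ m → All (_< k) (trim m β)
  trim<k m = drop⁺ m (take⁺ (M ∸ m) β<k)

  leftCarry<N : ∀ m → leftCarry m < N
  leftCarry<N m = final<N (>-nonZero⁻¹ N) (++⁺ (take⁺ m β<k) (take⁺ d (trim<k m)))

  rightCarry<N : ∀ m → rightCarry m < N
  rightCarry<N m = final<N (>-nonZero⁻¹ N) (++⁺ (take⁺ m β<k) (trim<k m))

  window<k^d : ∀ m → m + m + d ≤ M → fromDigits (window m) < k ^ d
  window<k^d m bound = subst (λ i → fromDigits (window m) < k ^ i) (length-window m bound)
    (fromDigits<k^length (take⁺ d (trim<k m)))

  state : ∀ m → m + m + d ≤ M → Fin K
  state m bound =
    combine (fromℕ< (leftCarry<N m)) (combine (fromℕ< (rightCarry<N m)) (fromℕ< (window<k^d m bound)))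

  state-injective : ∀ m₁ m₂ (b₁ : m₁ + m₁ + d ≤ M) (b₂ : m₂ + m₂ + d ≤ M) → state m₁ b₁ ≡ state m₂ b₂ →
    leftCarry m₁ ≡ leftCarry m₂ × rightCarry m₁ ≡ rightCarry m₂ × window m₁ ≡ window m₂
  state-injective m₁ m₂ b₁ b₂ eq =
    fromℕ<-injective _ _ (leftCarry<N m₁) (leftCarry<N m₂) (combine-injectiveˡ l₁ rest₁ l₂ rest₂ eq) ,
    fromℕ<-injective _ _ (rightCarry<N m₁) (rightCarry<N m₂) (combine-injectiveˡ r₁ w₁ r₂ w₂ same-rest) ,
    fromDigits-injective (take⁺ d (trim<k m₁)) (take⁺ d (trim<k m₂))
      (trans (length-window m₁ b₁) (sym (length-window m₂ b₂)))
      (fromℕ<-injective _ _ (window<k^d m₁ b₁) (window<k^d m₂ b₂) (combine-injectiveʳ r₁ w₁ r₂ w₂ same-rest))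
    where
    l₁ l₂ r₁ r₂ : Fin N
    w₁ w₂ : Fin (k ^ d)
    rest₁ rest₂ : Fin (N * k ^ d)
    l₁ = fromℕ< (leftCarry<N m₁)
    l₂ = fromℕ< (leftCarry<N m₂)
    r₁ = fromℕ< (rightCarry<N m₁)
    r₂ = fromℕ< (rightCarry<N m₂)
    w₁ = fromℕ< (window<k^d m₁ b₁)
    w₂ = fromℕ< (window<k^d m₂ b₂)
    rest₁ = combine r₁ w₁
    rest₂ = combine r₂ w₂
    same-rest : rest₁ ≡ rest₂
    same-rest = combine-injectiveʳ l₁ rest₁ l₂ rest₂ eq

  length-β-bound : (∀ A′ B′ → GoodPair k N A′ B′ → A ≤ A′) → M < suc K + suc K + d
  length-β-bound minimal = ≰⇒> λ big →
    let i , j , i<j , same = pigeonhole (n<1+n K) (λ i → state (suc (toℕ i)) (bound big i))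
        m₁ = suc (toℕ i)
        m₂ = suc (toℕ j)
        l , r , w = state-injective m₁ m₂ (bound big i) (bound big j) same
        A′ , B′ , good′ , A′<A = collision⇒smaller-pair m₁ m₂ (s≤s z≤n) (s≤s i<j) (bound big j) l r w
    in <⇒≱ A′<A (minimal A′ B′ good′)
    where
    bound : suc K + suc K + d ≤ M → (i : Fin (suc K)) → suc (toℕ i) + suc (toℕ i) + d ≤ M
    bound big i = ≤-trans (+-monoˡ-≤ d (+-mono-≤ (toℕ<n i) (toℕ<n i))) big

  length-α-bound : (∀ A′ B′ → GoodPair k N A′ B′ → A ≤ A′) →
    L ≤ 2 * (ceilLog k N + k ^ ceilLog k N * (N * N)) + 1
  length-α-bound minimal = begin
    L                                      ≡⟨ M+d≡L ⟨
    M + d                                  ≤⟨ +-monoˡ-≤ d (s≤s⁻¹ (length-β-bound minimal)) ⟩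
    K + suc K + d + d                      ≡⟨ solve-∀′ K d ⟩
    2 * (d + K) + 1                        ≤⟨ +-monoˡ-≤ 1 (*-monoʳ-≤ 2 (+-mono-≤ d≤ceilLog K≤)) ⟩
    2 * (c + k ^ c * (N * N)) + 1 ∎
    where
    open ≤-Reasoning
    c : ℕ
    c = ceilLog k N
    solve-∀′ : ∀ K d → K + suc K + d + d ≡ 2 * (d + K) + 1
    solve-∀′ = solve-∀
    K≤ : K ≤ k ^ c * (N * N)
    K≤ = begin
      N * (N * k ^ d)    ≡⟨ *-assoc N N (k ^ d) ⟨
      N * N * k ^ d      ≡⟨ *-comm (N * N) (k ^ d) ⟩
      k ^ d * (N * N)    ≤⟨ *-monoˡ-≤ (N * N) (^-monoʳ-≤ k d≤ceilLog) ⟩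
      k ^ c * (N * N) ∎

theorem7 : (k N : ℕ) → 2 ≤ k → 1 ≤ N → k ≤ N → ¬ (k ∣ N) →
    (A B : ℕ) → GoodPair k N A B →
    ((A' B' : ℕ) → GoodPair k N A' B' → A ≤ A') →
    length (digits k A)
      ≤ 2 * (ceilLog k N + k ^ ceilLog k N * (N * N) + ceilHalfLog k N) + 1
theorem7 k@(suc (suc k₀)) N@(suc _) (s≤s (s≤s z≤n)) _ _ _ A B (_ , _ , palα , palβ , A≡NB) minimal =
  ≤-trans (PalindromicPair.length-α-bound k₀ N palα palβ A≡NB minimal)
          (+-monoˡ-≤ 1 (*-monoʳ-≤ 2 (m≤m+n (ceilLog k N + k ^ ceilLog k N * (N * N)) (ceilHalfLog k N))))
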